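{- Let $w$ be a resolving involution of a finite group $G$. Then there exists a cyclic subgroup $C$ of $G$ such that $w$ is a resolving involution of $C$.
   Context: $\mathcal P_H$ is the power graph of a group $H$ (vertex set $H$, distinct elements adjacent iff one is a power of the other), with graph distance $d_{\mathcal P_H}$. For $x,y\in H$, $R\{x,y\}=\{z\in H: d_{\mathcal P_H}(x,z)\ne d_{\mathcal P_H}(y,z)\}$. $N(x)$, $N[x]$ are the open and closed neighbourhoods of $x$ in $\mathcal P_H$; $x\equiv y$ iff $N(x)=N(y)$ or $N[x]=N[y]$, and $\overline{x}$ is the equivalence class of $x$. A resolving involution of $H$ is an element $w$ of order $2$ for which there exist $x,y\in H\setminus\overline{w}$ with $R\{x,y\}=\{x,y,w\}$ (all computed in $\mathcal P_H$). -}

module Defs where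

open import Level using (0ℓ)
open import Data.Nat using (ℕ; zero; suc; _<_)
open import Data.Integer using (ℤ; +_; -[1+_])
open import Data.Fin using (Fin)
open import Data.Unit using (⊤)
open import Data.Product using (Σ; ∃; ∃-syntax; _×_; _,_)
open import Data.Sum using (_⊎_)
open import Relation.Nullary using (¬_)
open import Relation.Binary.PropositionalEquality using (_≡_; _≢_)
open import Algebra.Structures using (IsGroup)
open import Function.Bundles using (_⇔_)

-- A finite group: (up to isomorphism) a group structure on Fin n,
-- with propositional equality.
record FiniteGroup : Set where
  field
    order   : ℕ
    _∙_     : Fin order → Fin order → Fin order
    ε       : Fin order
    _⁻¹     : Fin order → Fin order
    isGroup : IsGroup _≡_ _∙_ ε _⁻¹

module _ (G : FiniteGroup) where
  open FiniteGroup G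

  Elt : Set
  Elt = Fin order

  _^ℕ_ : Elt → ℕ → Elt
  x ^ℕ zero  = ε
  x ^ℕ suc k = x ∙ (x ^ℕ k)

  _^ℤ_ : Elt → ℤ → Elt
  x ^ℤ (+ k)     = x ^ℕ k
  x ^ℤ -[1+ k ]  = (x ⁻¹) ^ℕ suc k

  IsPowerOf : Elt → Elt → Set
  IsPowerOf x y = ∃[ k ] x ≡ y ^ℤ k

  Subset : Set₁
  Subset = Elt → Set

  Whole : Subset
  Whole _ = ⊤

  record IsSubgroup (H : Subset) : Set where
    field
      has-ε : H ε
      ∙-closed : ∀ {x y} → H x → H y → H (x ∙ y)
      ⁻¹-closed : ∀ {x} → H x → H (x ⁻¹)

  IsCyclicSubgroup : Subset → Set
  IsCyclicSubgroup H = IsSubgroup H × (∃[ g ] (∀ x → H x ⇔ (∃[ k ] x ≡ g ^ℤ k)))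

  -- Everything below is the power graph 𝒫_H of a subgroup H (given as a
  -- subset, with the group operation of G restricted to H); for H = Whole
  -- this is 𝒫_G.
  module PowerGraph (H : Subset) where

    Adj : Elt → Elt → Set
    Adj x y = H x × H y × x ≢ y × (IsPowerOf x y ⊎ IsPowerOf y x)

    Walk : ℕ → Elt → Elt → Set
    Walk zero    x z = H x × x ≡ z
    Walk (suc k) x z = ∃[ y ] (Adj x y × Walk k y z)

    Dist : Elt → Elt → ℕ → Set
    Dist x z k = Walk k x z × (∀ j → j < k → ¬ Walk j x z)

    -- d(x,z) ≠ d(y,z)  (two distances are equal iff they agree on every k,
    -- which also covers the case of both being infinite)
    DistDiffer : Elt → Elt → Elt → Set
    DistDiffer x y z = ¬ (∀ k → Dist x z k ⇔ Dist y z k)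

    R : Elt → Elt → Subset
    R x y z = H z × DistDiffer x y z

    SameOpenNbhd : Elt → Elt → Set
    SameOpenNbhd x y = ∀ z → H z → (Adj x z ⇔ Adj y z)

    SameClosedNbhd : Elt → Elt → Set
    SameClosedNbhd x y = ∀ z → H z → ((z ≡ x ⊎ Adj x z) ⇔ (z ≡ y ⊎ Adj y z))

    Equiv : Elt → Elt → Set
    Equiv x y = SameOpenNbhd x y ⊎ SameClosedNbhd x y

    IsResolvingInvolution : Elt → Set
    IsResolvingInvolution w =
      H w × w ≢ ε × (w ∙ w) ≡ ε ×
      ∃[ x ] ∃[ y ] (H x × H y × ¬ Equiv x w × ¬ Equiv y w ×
        (∀ z → R x y z ⇔ (H z × (z ≡ x ⊎ z ≡ y ⊎ z ≡ w))))

  ResolvingInvolutionOf : Subset → Elt → Set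
  ResolvingInvolutionOf H w = PowerGraph.IsResolvingInvolution H w

-- A power graph whose vertex set contains ε has diameter at most 2, as ε is
-- adjacent to every other vertex; so a vertex z ∉ {x, y} lies in R{x,y} exactly when it is
-- adjacent to one of x, y but not to the other. Hence R{x,y} = {x,y,w} says that w is adjacent
-- to exactly one of them, say x, and that x and y have the same neighbours outside {x,y,w}.
-- From this one finds a cyclic subgroup containing x, y and w: ⟨x⟩ if x ≠ ε, and ⟨yw⟩ if
-- x = ε. Adjacency in the power graph of a subgroup is the restriction of that of G, so
-- R{x,y} is still {x,y,w} there; x and y stay inequivalent to w because x ~ y and y ≠ y⁻¹.
module Submission where

open import Defs
open import Data.Product using (Σ; ∃; ∃-syntax; _×_)
open import Data.Product using (_,_; proj₁; proj₂; ∃₂)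
open import Level using (0ℓ)
open import Data.Nat using (ℕ; zero; suc; _+_; _*_; _∸_; _<_; z≤n; s≤s)
open import Data.Nat.Properties using (n<1+n; m<n⇒0<n∸m; m+[n∸m]≡n; <⇒≤; +-comm)
open import Data.Nat.DivMod using (_%_; _/_; m≡m%n+[m/n]*n; m%n<n)
open import Data.Integer using (+_; -[1+_])
open import Data.Fin using (Fin; toℕ; fromℕ<; _≟_)
open import Data.Fin.Properties using (pigeonhole; any?; toℕ-fromℕ<)
open import Data.Unit using (tt)
open import Data.Sum using (_⊎_; inj₁; inj₂; [_,_]; swap)
import Data.Sum as Sum
open import Data.Empty using (⊥-elim)
open import Function using (_∘_; id)
open import Function.Bundles using (_⇔_; mk⇔; Equivalence)
open import Function.Construct.Symmetry using (⇔-sym)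
open import Relation.Nullary using (¬_; Dec; yes; no)
open import Relation.Nullary.Decidable using (decidable-stable)
import Relation.Nullary.Decidable as Dec
open import Relation.Binary.PropositionalEquality
  using (_≡_; _≢_; refl; sym; trans; cong; subst; module ≡-Reasoning)
open import Algebra.Structures using (IsGroup)
open import Algebra.Bundles using (Group)

open Equivalence using (to; from)

⇔-stable : ∀ {A B : Set} → Dec A → Dec B → ¬ ¬ (A ⇔ B) → A ⇔ B
⇔-stable A? B? ¬¬A⇔B = mk⇔
  (λ a → decidable-stable B? (λ ¬b → ¬¬A⇔B (λ A⇔B → ¬b (to A⇔B a))))
  (λ b → decidable-stable A? (λ ¬a → ¬¬A⇔B (λ A⇔B → ¬a (from A⇔B b))))

¬⇔-orient : ∀ {A B : Set} → Dec A → Dec B → ¬ (A ⇔ B) → (A × ¬ B) ⊎ (B × ¬ A)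
¬⇔-orient (yes a) (yes b) ¬A⇔B = ⊥-elim (¬A⇔B (mk⇔ (λ _ → b) (λ _ → a)))
¬⇔-orient (yes a) (no ¬b) _    = inj₁ (a , ¬b)
¬⇔-orient (no ¬a) (yes b) _    = inj₂ (b , ¬a)
¬⇔-orient (no ¬a) (no ¬b) ¬A⇔B = ⊥-elim (¬A⇔B (mk⇔ (⊥-elim ∘ ¬a) (⊥-elim ∘ ¬b)))

module _ (G : FiniteGroup) where
  open FiniteGroup G
  open IsGroup isGroup using (assoc; identityˡ; identityʳ; inverseʳ)

  group : Group 0ℓ 0ℓ
  group = record { isGroup = isGroup }

  open Group group using (monoid)
  open import Algebra.Properties.Group group
    using (∙-cancelˡ; identityˡ-unique; identityʳ-unique; inverseˡ-unique; inverseʳ-unique;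
           ⁻¹-involutive; \\-leftDividesʳ)
  open import Algebra.Properties.Monoid.Mult monoid
    using (×-homo-+; ×-assocˡ) renaming (_×_ to _·_)

  infixr 30 _^_
  _^_ : Elt G → ℕ → Elt G
  g ^ n = n · g

  ^ℕ≡^ : ∀ g n → _^ℕ_ G g n ≡ g ^ n
  ^ℕ≡^ g zero    = refl
  ^ℕ≡^ g (suc n) = cong (g ∙_) (^ℕ≡^ g n)

  ε^ : ∀ n → ε ^ n ≡ ε
  ε^ zero    = refl
  ε^ (suc n) = trans (identityˡ _) (ε^ n)

  finite-order : ∀ g → ∃[ m ] g ^ suc m ≡ ε
  finite-order g with pigeonhole (n<1+n order) (λ (i : Fin (suc order)) → g ^ toℕ i)
  ... | i , j , i<j , gⁱ≡gʲ = positive (m<n⇒0<n∸m i<j) gᵈ≡ε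
    where
    open ≡-Reasoning
    gᵈ≡ε : g ^ (toℕ j ∸ toℕ i) ≡ ε
    gᵈ≡ε = ∙-cancelˡ (g ^ toℕ i) _ _ (begin
      g ^ toℕ i ∙ g ^ (toℕ j ∸ toℕ i) ≡⟨ ×-homo-+ g (toℕ i) _ ⟨
      g ^ (toℕ i + (toℕ j ∸ toℕ i))   ≡⟨ cong (g ^_) (m+[n∸m]≡n (<⇒≤ i<j)) ⟩
      g ^ toℕ j                       ≡⟨ gⁱ≡gʲ ⟨
      g ^ toℕ i                       ≡⟨ identityʳ _ ⟨
      g ^ toℕ i ∙ ε                   ∎)
    positive : ∀ {d} → 0 < d → g ^ d ≡ ε → ∃[ m ] g ^ suc m ≡ ε
    positive {suc m} _ gᵈ≡ε = m , gᵈ≡ε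

  ^-mod : ∀ {g m} → g ^ suc m ≡ ε → ∀ j → g ^ j ≡ g ^ (j % suc m)
  ^-mod {g} {m} gᵐ⁺¹≡ε j = begin
    g ^ j                   ≡⟨ cong (g ^_) (m≡m%n+[m/n]*n j (suc m)) ⟩
    g ^ (r + q * suc m)     ≡⟨ ×-homo-+ g r _ ⟩
    g ^ r ∙ g ^ (q * suc m) ≡⟨ cong (g ^ r ∙_) (×-assocˡ g q (suc m)) ⟨
    g ^ r ∙ (g ^ suc m) ^ q ≡⟨ cong (λ x → g ^ r ∙ x ^ q) gᵐ⁺¹≡ε ⟩
    g ^ r ∙ ε ^ q           ≡⟨ cong (g ^ r ∙_) (ε^ q) ⟩
    g ^ r ∙ ε               ≡⟨ identityʳ _ ⟩
    g ^ r                   ∎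
    where
    open ≡-Reasoning
    r = j % suc m
    q = j / suc m

  -- Membership in ⟨g⟩ with natural exponents, which suffice because G is finite.
  infix 4 _∈⟨_⟩
  _∈⟨_⟩ : Elt G → Elt G → Set
  u ∈⟨ g ⟩ = ∃[ j ] u ≡ g ^ j

  ∈⟨⟩-ε : ∀ {g} → ε ∈⟨ g ⟩
  ∈⟨⟩-ε = 0 , refl

  ∈⟨⟩-refl : ∀ {g} → g ∈⟨ g ⟩
  ∈⟨⟩-refl {g} = 1 , sym (identityʳ g)

  ∈⟨⟩-trans : ∀ {u v g} → u ∈⟨ v ⟩ → v ∈⟨ g ⟩ → u ∈⟨ g ⟩
  ∈⟨⟩-trans {g = g} (i , refl) (j , refl) = i * j , ×-assocˡ g i j

  ∈⟨⟩-∙ : ∀ {u v g} → u ∈⟨ g ⟩ → v ∈⟨ g ⟩ → u ∙ v ∈⟨ g ⟩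
  ∈⟨⟩-∙ {g = g} (i , refl) (j , refl) = i + j , sym (×-homo-+ g i j)

  ⁻¹∈⟨⟩ : ∀ g → g ⁻¹ ∈⟨ g ⟩
  ⁻¹∈⟨⟩ g with m , gᵐ⁺¹≡ε ← finite-order g = m , sym (inverseʳ-unique g (g ^ m) gᵐ⁺¹≡ε)

  ∈⟨⟩-⁻¹ : ∀ {u g} → u ∈⟨ g ⟩ → u ⁻¹ ∈⟨ g ⟩
  ∈⟨⟩-⁻¹ {u} = ∈⟨⟩-trans (⁻¹∈⟨⟩ u)

  ∈⟨⁻¹⟩⇒∈⟨⟩ : ∀ {u g} → u ∈⟨ g ⁻¹ ⟩ → u ∈⟨ g ⟩
  ∈⟨⁻¹⟩⇒∈⟨⟩ {g = g} u∈⟨g⁻¹⟩ = ∈⟨⟩-trans u∈⟨g⁻¹⟩ (⁻¹∈⟨⟩ g)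

  ⁻¹∈⟨⟩⇒∈⟨⟩ : ∀ {u g} → u ⁻¹ ∈⟨ g ⟩ → u ∈⟨ g ⟩
  ⁻¹∈⟨⟩⇒∈⟨⟩ {u} {g} = subst (_∈⟨ g ⟩) (⁻¹-involutive u) ∘ ∈⟨⟩-⁻¹

  ∈⟨⟩-cancelˡ : ∀ {u v g} → u ∈⟨ g ⟩ → u ∙ v ∈⟨ g ⟩ → v ∈⟨ g ⟩
  ∈⟨⟩-cancelˡ {u} {v} {g} u∈⟨g⟩ uv∈⟨g⟩ =
    subst (_∈⟨ g ⟩) (\\-leftDividesʳ u v) (∈⟨⟩-∙ (∈⟨⟩-⁻¹ u∈⟨g⟩) uv∈⟨g⟩)

  ∈⟨⟩-comm : ∀ {u v g} → u ∈⟨ g ⟩ → v ∈⟨ g ⟩ → u ∙ v ≡ v ∙ u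
  ∈⟨⟩-comm {g = g} (i , refl) (j , refl) = begin
    g ^ i ∙ g ^ j ≡⟨ ×-homo-+ g i j ⟨
    g ^ (i + j)   ≡⟨ cong (g ^_) (+-comm i j) ⟩
    g ^ (j + i)   ≡⟨ ×-homo-+ g j i ⟩
    g ^ j ∙ g ^ i ∎
    where open ≡-Reasoning

  ∈⟨⟩-involution : ∀ {u g} → g ∙ g ≡ ε → u ∈⟨ g ⟩ → u ≡ ε ⊎ u ≡ g
  ∈⟨⟩-involution g²≡ε (zero , refl) = inj₁ refl
  ∈⟨⟩-involution {g = g} g²≡ε (suc j , refl) with ∈⟨⟩-involution g²≡ε (j , refl)
  ... | inj₁ gʲ≡ε = inj₂ (trans (cong (g ∙_) gʲ≡ε) (identityʳ g))
  ... | inj₂ gʲ≡g = inj₁ (trans (cong (g ∙_) gʲ≡g) g²≡ε)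

  _∈⟨_⟩? : ∀ u g → Dec (u ∈⟨ g ⟩)
  u ∈⟨ g ⟩? with m , gᵐ⁺¹≡ε ← finite-order g =
    Dec.map (mk⇔ (λ (i , u≡gⁱ) → toℕ i , u≡gⁱ) reduce) (any? (λ i → u ≟ g ^ toℕ i))
    where
    reduce : u ∈⟨ g ⟩ → ∃[ i ] u ≡ g ^ toℕ i
    reduce (j , u≡gʲ) = fromℕ< (m%n<n j (suc m)) ,
      trans u≡gʲ (trans (^-mod gᵐ⁺¹≡ε j) (cong (g ^_) (sym (toℕ-fromℕ< (m%n<n j (suc m))))))

  IsPowerOf⇔∈⟨⟩ : ∀ {u g} → IsPowerOf G u g ⇔ u ∈⟨ g ⟩
  IsPowerOf⇔∈⟨⟩ {u} {g} = mk⇔ natural (λ (j , u≡gʲ) → + j , trans u≡gʲ (sym (^ℕ≡^ g j)))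
    where
    natural : IsPowerOf G u g → u ∈⟨ g ⟩
    natural (+ j , refl)      = j , ^ℕ≡^ g j
    natural (-[1+ j ] , refl) = ∈⟨⁻¹⟩⇒∈⟨⟩ (suc j , ^ℕ≡^ (g ⁻¹) (suc j))

  Cyclic : Elt G → Subset G
  Cyclic g u = u ∈⟨ g ⟩

  Cyclic-isSubgroup : ∀ g → IsSubgroup G (Cyclic g)
  Cyclic-isSubgroup g = record { has-ε = ∈⟨⟩-ε ; ∙-closed = ∈⟨⟩-∙ ; ⁻¹-closed = ∈⟨⟩-⁻¹ }

  Cyclic-isCyclicSubgroup : ∀ g → IsCyclicSubgroup G (Cyclic g)
  Cyclic-isCyclicSubgroup g = Cyclic-isSubgroup g , g , λ _ → ⇔-sym IsPowerOf⇔∈⟨⟩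

  x⁻¹≡x⇒x∙x≡ε : ∀ {x} → x ⁻¹ ≡ x → x ∙ x ≡ ε
  x⁻¹≡x⇒x∙x≡ε {x} x⁻¹≡x = trans (cong (x ∙_) (sym x⁻¹≡x)) (inverseʳ x)

  ∙-involution : ∀ {x y} → x ∙ x ≡ ε → y ∙ y ≡ ε → x ∙ y ≡ y ∙ x → (x ∙ y) ∙ (x ∙ y) ≡ ε
  ∙-involution {x} {y} x²≡ε y²≡ε xy≡yx = begin
    (x ∙ y) ∙ (x ∙ y) ≡⟨ assoc x y (x ∙ y) ⟩
    x ∙ (y ∙ (x ∙ y)) ≡⟨ cong (λ z → x ∙ (y ∙ z)) xy≡yx ⟩
    x ∙ (y ∙ (y ∙ x)) ≡⟨ cong (x ∙_) (assoc y y x) ⟨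
    x ∙ ((y ∙ y) ∙ x) ≡⟨ cong (λ z → x ∙ (z ∙ x)) y²≡ε ⟩
    x ∙ (ε ∙ x)       ≡⟨ cong (x ∙_) (identityˡ x) ⟩
    x ∙ x             ≡⟨ x²≡ε ⟩
    ε                 ∎
    where open ≡-Reasoning

  Adjacent : Elt G → Elt G → Set
  Adjacent x y = x ≢ y × (x ∈⟨ y ⟩ ⊎ y ∈⟨ x ⟩)

  Adjacent-sym : ∀ {x y} → Adjacent x y → Adjacent y x
  Adjacent-sym (x≢y , p) = x≢y ∘ sym , swap p

  Adjacent? : ∀ x y → Dec (Adjacent x y)
  Adjacent? x y with x ≟ y
  ... | yes x≡y = no (λ (x≢y , _) → x≢y x≡y)
  ... | no x≢y  = Dec.map′ (x≢y ,_) proj₂ ((x ∈⟨ y ⟩?) Dec.⊎-dec (y ∈⟨ x ⟩?))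

  ε-Adjacent : ∀ {x} → x ≢ ε → Adjacent ε x
  ε-Adjacent x≢ε = x≢ε ∘ sym , inj₁ ∈⟨⟩-ε

  Adjacent-⁻¹ : ∀ {x} → x ⁻¹ ≢ x → Adjacent x (x ⁻¹)
  Adjacent-⁻¹ {x} x⁻¹≢x = x⁻¹≢x ∘ sym , inj₂ (⁻¹∈⟨⟩ x)

  Adjacent-⁻¹ʳ : ∀ {x y} → x ≢ y → Adjacent x (y ⁻¹) → Adjacent x y
  Adjacent-⁻¹ʳ x≢y (_ , inj₁ x∈⟨y⁻¹⟩) = x≢y , inj₁ (∈⟨⁻¹⟩⇒∈⟨⟩ x∈⟨y⁻¹⟩)
  Adjacent-⁻¹ʳ x≢y (_ , inj₂ y⁻¹∈⟨x⟩) = x≢y , inj₂ (⁻¹∈⟨⟩⇒∈⟨⟩ y⁻¹∈⟨x⟩)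

  involutions-nonadjacent : ∀ {x y} → x ∙ x ≡ ε → y ∙ y ≡ ε → x ≢ ε → y ≢ ε → ¬ Adjacent x y
  involutions-nonadjacent x²≡ε y²≡ε x≢ε y≢ε (x≢y , inj₁ x∈⟨y⟩) =
    [ x≢ε , x≢y ] (∈⟨⟩-involution y²≡ε x∈⟨y⟩)
  involutions-nonadjacent x²≡ε y²≡ε x≢ε y≢ε (x≢y , inj₂ y∈⟨x⟩) =
    [ y≢ε , x≢y ∘ sym ] (∈⟨⟩-involution x²≡ε y∈⟨x⟩)

  module PowerGraphDistance {H : Subset G} (ε∈H : H ε) where
    open PowerGraph G H

    Adj⇔Adjacent : ∀ {x y} → H x → H y → Adj x y ⇔ Adjacent x y
    Adj⇔Adjacent x∈H y∈H = mk⇔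
      (λ (_ , _ , x≢y , p) → x≢y , Sum.map (to IsPowerOf⇔∈⟨⟩) (to IsPowerOf⇔∈⟨⟩) p)
      (λ (x≢y , p) → x∈H , y∈H , x≢y , Sum.map (from IsPowerOf⇔∈⟨⟩) (from IsPowerOf⇔∈⟨⟩) p)

    Walk₁⇔Adjacent : ∀ {x z} → H x → H z → Walk 1 x z ⇔ Adjacent x z
    Walk₁⇔Adjacent x∈H z∈H = mk⇔
      (λ { (_ , adj , _ , refl) → to (Adj⇔Adjacent x∈H z∈H) adj })
      (λ adj → _ , from (Adj⇔Adjacent x∈H z∈H) adj , z∈H , refl)

    Walk≤2 : ∀ {x z} → H x → H z → x ≢ z → Walk 1 x z ⊎ Walk 2 x z
    Walk≤2 {x} {z} x∈H z∈H x≢z with x ≟ ε | z ≟ ε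
    ... | yes refl | _        = inj₁ (from (Walk₁⇔Adjacent x∈H z∈H) (ε-Adjacent (x≢z ∘ sym)))
    ... | no x≢ε   | yes refl = inj₁ (from (Walk₁⇔Adjacent x∈H z∈H) (Adjacent-sym (ε-Adjacent x≢ε)))
    ... | no x≢ε   | no z≢ε   = inj₂ (ε , from (Adj⇔Adjacent x∈H ε∈H) (Adjacent-sym (ε-Adjacent x≢ε))
                                        , from (Walk₁⇔Adjacent ε∈H z∈H) (ε-Adjacent z≢ε))

    Dist-Adjacent : ∀ {x z} → H x → H z → Adjacent x z → Dist x z 1
    Dist-Adjacent x∈H z∈H adj@(x≢z , _) =
      from (Walk₁⇔Adjacent x∈H z∈H) adj , λ { zero _ (_ , x≡z) → x≢z x≡z ; (suc _) (s≤s ()) }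

    Dist-¬Adjacent : ∀ {x z} → H x → H z → x ≢ z → ¬ Adjacent x z → Dist x z 2
    Dist-¬Adjacent x∈H z∈H x≢z ¬adj =
      [ ⊥-elim ∘ ¬adj ∘ to (Walk₁⇔Adjacent x∈H z∈H) , id ] (Walk≤2 x∈H z∈H x≢z)
      , λ { zero _ (_ , x≡z) → x≢z x≡z
          ; (suc zero) _ walk → ¬adj (to (Walk₁⇔Adjacent x∈H z∈H) walk)
          ; (suc (suc _)) (s≤s (s≤s ())) }

    Dist-cases : ∀ {x z k} → H x → H z → x ≢ z → Dist x z k →
                 (k ≡ 1 × Adjacent x z) ⊎ (k ≡ 2 × ¬ Adjacent x z)
    Dist-cases {k = zero} _ _ x≢z ((_ , x≡z) , _) = ⊥-elim (x≢z x≡z)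
    Dist-cases {k = 1} x∈H z∈H _ (walk , _) = inj₁ (refl , to (Walk₁⇔Adjacent x∈H z∈H) walk)
    Dist-cases {k = 2} x∈H z∈H _ (_ , shorter) =
      inj₂ (refl , shorter 1 (s≤s (s≤s z≤n)) ∘ from (Walk₁⇔Adjacent x∈H z∈H))
    Dist-cases {k = suc (suc (suc _))} x∈H z∈H x≢z (_ , shorter) =
      ⊥-elim ([ shorter 1 (s≤s (s≤s z≤n)) , shorter 2 (s≤s (s≤s (s≤s z≤n))) ] (Walk≤2 x∈H z∈H x≢z))

    Dist-transfer : ∀ {x y z k} → H x → H y → H z → x ≢ z → y ≢ z →
                    (Adjacent x z ⇔ Adjacent y z) → Dist x z k → Dist y z k
    Dist-transfer x∈H y∈H z∈H x≢z y≢z same dist with Dist-cases x∈H z∈H x≢z dist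
    ... | inj₁ (refl , adj)  = Dist-Adjacent y∈H z∈H (to same adj)
    ... | inj₂ (refl , ¬adj) = Dist-¬Adjacent y∈H z∈H y≢z (¬adj ∘ from same)

    sameDist⇔sameAdjacency : ∀ {x y z} → H x → H y → H z → x ≢ z → y ≢ z →
      (∀ k → Dist x z k ⇔ Dist y z k) ⇔ (Adjacent x z ⇔ Adjacent y z)
    sameDist⇔sameAdjacency {z = z} x∈H y∈H z∈H x≢z y≢z = mk⇔
      (λ same → mk⇔ (adjacency x∈H y∈H (to (same 1))) (adjacency y∈H x∈H (from (same 1))))
      (λ same k → mk⇔ (Dist-transfer x∈H y∈H z∈H x≢z y≢z same)
                      (Dist-transfer y∈H x∈H z∈H y≢z x≢z (⇔-sym same)))
      where
      adjacency : ∀ {u v} → H u → H v → (Dist u z 1 → Dist v z 1) → Adjacent u z → Adjacent v z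
      adjacency u∈H v∈H dist = to (Walk₁⇔Adjacent v∈H z∈H) ∘ proj₁ ∘ dist ∘ Dist-Adjacent u∈H z∈H

    DistDiffer⇔¬sameAdjacency : ∀ {x y z} → H x → H y → H z → x ≢ z → y ≢ z →
      DistDiffer x y z ⇔ (¬ (Adjacent x z ⇔ Adjacent y z))
    DistDiffer⇔¬sameAdjacency x∈H y∈H z∈H x≢z y≢z = mk⇔
      (λ differ same → differ (from equivalent same))
      (λ ¬same same → ¬same (to equivalent same))
      where equivalent = sameDist⇔sameAdjacency x∈H y∈H z∈H x≢z y≢z

    DistDifferˡ : ∀ {x y} → H x → x ≢ y → DistDiffer x y x
    DistDifferˡ x∈H x≢y same = x≢y (sym (proj₂ (proj₁ (to (same 0) ((x∈H , refl) , λ _ ())))))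

    DistDifferʳ : ∀ {x y} → H y → x ≢ y → DistDiffer x y y
    DistDifferʳ y∈H x≢y same = x≢y (proj₂ (proj₁ (from (same 0) ((y∈H , refl) , λ _ ()))))

  -- R{a,b} = {a,b,w} in 𝒫_G for the involution w, oriented so that w is adjacent to a but not to b.
  record ResolvingPair (w a b : Elt G) : Set where
    field
      w≢ε   : w ≢ ε
      w²≡ε  : w ∙ w ≡ ε
      b≢w   : b ≢ w
      a~w   : Adjacent a w
      b≁w   : ¬ Adjacent b w
      agree : ∀ z → z ≢ a → z ≢ b → z ≢ w → Adjacent a z ⇔ Adjacent b z

    a≢w : a ≢ w
    a≢w = proj₁ a~w

    a≢b : a ≢ b
    a≢b a≡b = b≁w (subst (λ x → Adjacent x w) a≡b a~w)

    b≢ε : b ≢ ε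
    b≢ε b≡ε = b≁w (subst (λ x → Adjacent x w) (sym b≡ε) (ε-Adjacent w≢ε))

    w⁻¹≡w : w ⁻¹ ≡ w
    w⁻¹≡w = sym (inverseˡ-unique w w w²≡ε)

    bw≢ε : b ∙ w ≢ ε
    bw≢ε bw≡ε = b≢w (trans (inverseˡ-unique b w bw≡ε) w⁻¹≡w)

    bw≢b : b ∙ w ≢ b
    bw≢b = w≢ε ∘ identityʳ-unique b w

    bw≢w : b ∙ w ≢ w
    bw≢w = b≢ε ∘ identityˡ-unique b w

    -- If b were an involution then so would be bw, and the involutions b, bw are never adjacent.
    b⁻¹≢b : b ∙ w ≡ w ∙ b → (b ∙ b ≡ ε → Adjacent a (b ∙ w)) → b ⁻¹ ≢ b
    b⁻¹≢b bw≡wb a~bw b⁻¹≡b =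
      involutions-nonadjacent b²≡ε (∙-involution b²≡ε w²≡ε bw≡wb) b≢ε bw≢ε
        (to (agree (b ∙ w) (proj₁ (a~bw b²≡ε) ∘ sym) bw≢b bw≢w) (a~bw b²≡ε))
      where b²≡ε = x⁻¹≡x⇒x∙x≡ε b⁻¹≡b

  resolvingInvolution⇒resolvingPair : ∀ {w} → ResolvingInvolutionOf G (Whole G) w → ∃₂ (ResolvingPair w)
  resolvingInvolution⇒resolvingPair {w} (_ , w≢ε , w²≡ε , x , y , _ , _ , x∉[w] , y∉[w] , R≡) =
    orient (¬⇔-orient (Adjacent? x w) (Adjacent? y w) w-separates)
    where
    open PowerGraph G (Whole G)
    open PowerGraphDistance {Whole G} tt

    ≢w : ∀ {v} → ¬ Equiv v w → v ≢ w
    ≢w v∉[w] refl = v∉[w] (inj₁ (λ _ _ → mk⇔ id id))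

    w-separates : ¬ (Adjacent x w ⇔ Adjacent y w)
    w-separates = to (DistDiffer⇔¬sameAdjacency tt tt tt (≢w x∉[w]) (≢w y∉[w]))
                     (proj₂ (from (R≡ w) (tt , inj₂ (inj₂ refl))))

    agree : ∀ z → z ≢ x → z ≢ y → z ≢ w → Adjacent x z ⇔ Adjacent y z
    agree z z≢x z≢y z≢w = ⇔-stable (Adjacent? x z) (Adjacent? y z) λ ¬same →
      [ z≢x , [ z≢y , z≢w ] ] (proj₂ (to (R≡ z)
        (tt , from (DistDiffer⇔¬sameAdjacency tt tt tt (z≢x ∘ sym) (z≢y ∘ sym)) ¬same)))

    orient : (Adjacent x w × ¬ Adjacent y w) ⊎ (Adjacent y w × ¬ Adjacent x w) → ∃₂ (ResolvingPair w)
    orient (inj₁ (x~w , y≁w)) = x , y , record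
      { w≢ε = w≢ε ; w²≡ε = w²≡ε ; b≢w = ≢w y∉[w] ; a~w = x~w ; b≁w = y≁w ; agree = agree }
    orient (inj₂ (y~w , x≁w)) = y , x , record
      { w≢ε = w≢ε ; w²≡ε = w²≡ε ; b≢w = ≢w x∉[w] ; a~w = y~w ; b≁w = x≁w
      ; agree = λ z z≢y z≢x z≢w → ⇔-sym (agree z z≢x z≢y z≢w) }

  -- A cyclic subgroup ⟨g⟩ containing a, b, w, with the two facts that keep a and b
  -- inequivalent to w in the power graph of ⟨g⟩.
  record ResolvingGenerator (w a b : Elt G) : Set where
    field
      g     : Elt G
      a∈⟨g⟩ : a ∈⟨ g ⟩
      b∈⟨g⟩ : b ∈⟨ g ⟩
      w∈⟨g⟩ : w ∈⟨ g ⟩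
      a~b   : Adjacent a b
      b⁻¹≢b : b ⁻¹ ≢ b

  resolvingGenerator-ε : ∀ {w b} → ResolvingPair w ε b → ResolvingGenerator w ε b
  resolvingGenerator-ε {w} {b} pair = record
    { g = b ∙ w ; a∈⟨g⟩ = ∈⟨⟩-ε ; b∈⟨g⟩ = b∈⟨bw⟩ ; w∈⟨g⟩ = w∈⟨bw⟩ ; a~b = ε-Adjacent b≢ε
    ; b⁻¹≢b = b⁻¹≢b (∈⟨⟩-comm b∈⟨bw⟩ w∈⟨bw⟩) (λ _ → ε-Adjacent bw≢ε) }
    where
    open ResolvingPair pair

    b∈⟨bw⟩ : b ∈⟨ b ∙ w ⟩
    b∈⟨bw⟩ with to (agree (b ∙ w) bw≢ε bw≢b bw≢w) (ε-Adjacent bw≢ε)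
    ... | _ , inj₁ b∈⟨bw⟩ = b∈⟨bw⟩
    ... | _ , inj₂ bw∈⟨b⟩ = ⊥-elim (b≁w (b≢w , inj₂ (∈⟨⟩-cancelˡ ∈⟨⟩-refl bw∈⟨b⟩)))

    w∈⟨bw⟩ : w ∈⟨ b ∙ w ⟩
    w∈⟨bw⟩ = ∈⟨⟩-cancelˡ b∈⟨bw⟩ ∈⟨⟩-refl

  resolvingGenerator-≢ε : ∀ {w a b} → ResolvingPair w a b → a ≢ ε → ResolvingGenerator w a b
  resolvingGenerator-≢ε {w} {a} {b} pair a≢ε = record
    { g = a ; a∈⟨g⟩ = ∈⟨⟩-refl ; b∈⟨g⟩ = b∈⟨a⟩ ; w∈⟨g⟩ = w∈⟨a⟩ ; a~b = a≢b , inj₂ b∈⟨a⟩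
    ; b⁻¹≢b = b⁻¹≢b (∈⟨⟩-comm b∈⟨a⟩ w∈⟨a⟩) a~bw }
    where
    open ResolvingPair pair

    w∈⟨a⟩ : w ∈⟨ a ⟩
    w∈⟨a⟩ with a~w
    ... | _ , inj₁ a∈⟨w⟩ = ⊥-elim ([ a≢ε , a≢w ] (∈⟨⟩-involution w²≡ε a∈⟨w⟩))
    ... | _ , inj₂ w∈⟨a⟩ = w∈⟨a⟩

    a²≢ε : a ∙ a ≢ ε
    a²≢ε a²≡ε = [ w≢ε , a≢w ∘ sym ] (∈⟨⟩-involution a²≡ε w∈⟨a⟩)

    a∉⟨b⟩ : ¬ a ∈⟨ b ⟩
    a∉⟨b⟩ a∈⟨b⟩ = b≁w (b≢w , inj₂ (∈⟨⟩-trans w∈⟨a⟩ a∈⟨b⟩))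

    a⁻¹≢a : a ⁻¹ ≢ a
    a⁻¹≢a = a²≢ε ∘ x⁻¹≡x⇒x∙x≡ε

    a⁻¹≢b : a ⁻¹ ≢ b
    a⁻¹≢b a⁻¹≡b = a∉⟨b⟩ (⁻¹∈⟨⟩⇒∈⟨⟩ (subst (a ⁻¹ ∈⟨_⟩) a⁻¹≡b ∈⟨⟩-refl))

    a⁻¹≢w : a ⁻¹ ≢ w
    a⁻¹≢w a⁻¹≡w = a≢w (trans (sym (⁻¹-involutive a)) (trans (cong _⁻¹ a⁻¹≡w) w⁻¹≡w))

    b∈⟨a⟩ : b ∈⟨ a ⟩
    b∈⟨a⟩ with Adjacent-⁻¹ʳ (a≢b ∘ sym) (to (agree (a ⁻¹) a⁻¹≢a a⁻¹≢b a⁻¹≢w) (Adjacent-⁻¹ a⁻¹≢a))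
    ... | _ , inj₁ b∈⟨a⟩ = b∈⟨a⟩
    ... | _ , inj₂ a∈⟨b⟩ = ⊥-elim (a∉⟨b⟩ a∈⟨b⟩)

    a~bw : b ∙ b ≡ ε → Adjacent a (b ∙ w)
    a~bw b²≡ε = (λ a≡bw → a²≢ε (subst (λ x → x ∙ x ≡ ε) (sym a≡bw) bw²≡ε)) , inj₂ (∈⟨⟩-∙ b∈⟨a⟩ w∈⟨a⟩)
      where bw²≡ε = ∙-involution b²≡ε w²≡ε (∈⟨⟩-comm b∈⟨a⟩ w∈⟨a⟩)

  resolvingGenerator : ∀ {w a b} → ResolvingPair w a b → ResolvingGenerator w a b
  resolvingGenerator {a = a} pair with a ≟ ε
  ... | yes refl = resolvingGenerator-ε pair
  ... | no a≢ε   = resolvingGenerator-≢ε pair a≢ε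

  resolvingInvolution-inSubgroup : ∀ {H w a b} → IsSubgroup G H → H a → H b → H w →
    ResolvingPair w a b → Adjacent a b → b ⁻¹ ≢ b → ResolvingInvolutionOf G H w
  resolvingInvolution-inSubgroup {H} {w} {a} {b} H-subgroup a∈H b∈H w∈H pair a~b b⁻¹≢b =
    w∈H , w≢ε , w²≡ε , a , b , a∈H , b∈H , a∉[w] , b∉[w] , R≡
    where
    open ResolvingPair pair hiding (b⁻¹≢b)
    open IsSubgroup H-subgroup using (has-ε; ⁻¹-closed)
    open PowerGraph G H
    open PowerGraphDistance {H} has-ε

    b∉N[w] : ¬ (b ≡ w ⊎ Adj w b)
    b∉N[w] = [ b≢w , b≁w ∘ Adjacent-sym ∘ to (Adj⇔Adjacent w∈H b∈H) ]

    a∉[w] : ¬ Equiv a w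
    a∉[w] (inj₁ sameOpen) = proj₁ (to (Adj⇔Adjacent w∈H w∈H)
      (to (sameOpen w w∈H) (from (Adj⇔Adjacent a∈H w∈H) a~w))) refl
    a∉[w] (inj₂ sameClosed) = b∉N[w] (to (sameClosed b b∈H) (inj₂ (from (Adj⇔Adjacent a∈H b∈H) a~b)))

    b∉[w] : ¬ Equiv b w
    b∉[w] (inj₁ sameOpen) = b≁w (Adjacent-sym (Adjacent-⁻¹ʳ (b≢w ∘ sym)
      (to (Adj⇔Adjacent w∈H b⁻¹∈H)
        (to (sameOpen (b ⁻¹) b⁻¹∈H) (from (Adj⇔Adjacent b∈H b⁻¹∈H) (Adjacent-⁻¹ b⁻¹≢b))))))
      where b⁻¹∈H = ⁻¹-closed b∈H
    b∉[w] (inj₂ sameClosed) = b∉N[w] (to (sameClosed b b∈H) (inj₁ refl))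

    in-triple : ∀ {z} → H z → DistDiffer a b z → z ≡ a ⊎ z ≡ b ⊎ z ≡ w
    in-triple {z} z∈H differ with z ≟ a | z ≟ b | z ≟ w
    ... | yes z≡a | _       | _       = inj₁ z≡a
    ... | no _    | yes z≡b | _       = inj₂ (inj₁ z≡b)
    ... | no _    | no _    | yes z≡w = inj₂ (inj₂ z≡w)
    ... | no z≢a  | no z≢b  | no z≢w  = ⊥-elim
      (to (DistDiffer⇔¬sameAdjacency a∈H b∈H z∈H (z≢a ∘ sym) (z≢b ∘ sym)) differ (agree z z≢a z≢b z≢w))

    triple-differs : ∀ {z} → z ≡ a ⊎ z ≡ b ⊎ z ≡ w → DistDiffer a b z
    triple-differs (inj₁ refl)         = DistDifferˡ a∈H a≢b
    triple-differs (inj₂ (inj₁ refl))  = DistDifferʳ b∈H a≢b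
    triple-differs (inj₂ (inj₂ refl))  =
      from (DistDiffer⇔¬sameAdjacency a∈H b∈H w∈H a≢w b≢w) (λ same → b≁w (to same a~w))

    R≡ : ∀ z → R a b z ⇔ (H z × (z ≡ a ⊎ z ≡ b ⊎ z ≡ w))
    R≡ z = mk⇔ (λ (z∈H , differ) → z∈H , in-triple z∈H differ)
               (λ (z∈H , z∈triple) → z∈H , triple-differs z∈triple)

lemma3p14 : (G : FiniteGroup) (w : Elt G) →
    ResolvingInvolutionOf G (Whole G) w →
    ∃[ C ] (IsCyclicSubgroup G C × ResolvingInvolutionOf G C w)
lemma3p14 G w resolving with a , b , pair ← resolvingInvolution⇒resolvingPair G resolving =
  Cyclic G g , Cyclic-isCyclicSubgroup G g ,
  resolvingInvolution-inSubgroup G (Cyclic-isSubgroup G g) a∈⟨g⟩ b∈⟨g⟩ w∈⟨g⟩ pair a~b b⁻¹≢b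
  where open ResolvingGenerator (resolvingGenerator G pair)
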